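{- Let $q$ be a prime power with $q\equiv 5\pmod 8$ and consider the directed graph $\mathcal{J}_{\mathbb{F}_q}$ defined below. Let $C$ be the set of vertices of a directed cycle in $\mathcal{J}_{\mathbb{F}_q}$. Then every $c\in C$ has exactly two children; one of them lies in the cycle, and the other one has no children.
   Context: $\mathbb{F}_q$ is the finite field with $q$ elements. $\phi_q\colon \mathbb{F}_q^\times\to\{\pm1\}$ is the quadratic character: $\phi_q(a)=1$ if $a$ is a square in $\mathbb{F}_q^\times$ and $-1$ otherwise. The directed graph $\mathcal{J}_{\mathbb{F}_q}=(V,E)$ has vertex set $V=\{(a,b)\in(\mathbb{F}_q^\times)^2 : \phi_q(ab)=1,\ a\neq \pm b\}$, and for $(a,b),(c,d)\in V$ there is an edge $(a,b)\to(c,d)$ if and only if $c=\frac{a+b}{2}$ and $d^2=ab$. A vertex $u$ is a child of $v$ if there is an edge $v\to u$, and a parent of $v$ if there is an edge $u\to v$. -}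

module Defs where

open import Level using (0ℓ)
open import Data.Nat using (ℕ; suc; NonZero)
open import Data.Nat.DivMod using (_mod_)
open import Data.Fin using (Fin; toℕ)
open import Data.Product using (Σ; ∃; _×_; _,_)
open import Relation.Binary.PropositionalEquality using (_≡_; _≢_)
open import Relation.Nullary using (¬_)
open import Function.Bundles using (_↔_)
open import Function.Definitions using (Injective)
open import Algebra.Structures using (IsCommutativeRing)

record FiniteField (q : ℕ) : Set₁ where
  infixl 6 _+_
  infixl 7 _*_
  field
    Carrier : Set
    _+_ _*_ : Carrier → Carrier → Carrier
    -_ : Carrier → Carrier
    0# 1# : Carrier
    _⁻¹ : Carrier → Carrier
    isCommutativeRing : IsCommutativeRing _≡_ _+_ _*_ -_ 0# 1#
    0≢1 : 0# ≢ 1#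
    inverseʳ : ∀ x → x ≢ 0# → x * (x ⁻¹) ≡ 1#
    enumeration : Fin q ↔ Carrier

module JGraph {q : ℕ} (F : FiniteField q) where
  open FiniteField F

  two : Carrier
  two = 1# + 1#

  IsSquare : Carrier → Set
  IsSquare a = ∃ λ b → b * b ≡ a

  φ≡1 : Carrier → Set
  φ≡1 a = a ≢ 0# × IsSquare a

  Vertex : Set
  Vertex = Carrier × Carrier

  IsVertex : Vertex → Set
  IsVertex (a , b) = a ≢ 0# × b ≢ 0# × φ≡1 (a * b) × a ≢ b × a ≢ - b

  Edge : Vertex → Vertex → Set
  Edge (a , b) (c , d) =
    IsVertex (a , b) × IsVertex (c , d) × c ≡ (a + b) * (two ⁻¹) × d * d ≡ a * b

  next : ∀ {n} → Fin (suc n) → Fin (suc n)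
  next {n} i = suc (toℕ i) mod suc n

  record DirectedCycle (n : ℕ) : Set where
    field
      vtx : Fin (suc n) → Vertex
      distinct : Injective _≡_ _≡_ vtx
      isVertex : ∀ i → IsVertex (vtx i)
      edge : ∀ i → Edge (vtx i) (vtx (next i))

  _∈C_ : ∀ {n} → Vertex → DirectedCycle n → Set
  u ∈C cyc = ∃ λ j → DirectedCycle.vtx cyc j ≡ u

  HasNoChildren : Vertex → Set
  HasNoChildren u = ∀ w → ¬ Edge u w

-- Write a child of (a, b) as (c, d), so 2c = a + b and d² = ab. Every child of (a, b) is (c, ±d),
-- and (c, -d) is again a vertex because -1 is a square in F_q. Suppose (c, d) has a child (f′, g′),
-- as it does on a cycle, and (c, -d) has a child (f, g). Then 16 f f′ = (a - b)², while f g and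
-- f′ g′ are squares, so g g′ = m² is a square too. With cd = t², (g g′)² = -(cd)² gives
-- (m/t)⁴ = -1, an element of order 8 in F_q^×, which cannot exist because 8 ∤ q - 1.
-- The three facts about F_q (2 ≠ 0, -1 a square, no element of order 8) come from counting the
-- orbits of free actions: x ↦ x + 1 on F_q, the Klein group x ↦ ±x^{±1} on F_q ∖ {0, ±1},
-- and multiplication by powers of s on F_q^×.

module Submission where

open import Defs
open import Data.Nat using (ℕ)
open import Data.Nat.DivMod using (_%_)
open import Data.Product using (∃; ∃₂; _×_)
open import Data.Sum using (_⊎_)
open import Relation.Binary.PropositionalEquality using (_≡_; _≢_)

open import Level using (0ℓ)
open import Data.Nat using (zero; suc; _<_; _≤_; _∸_; s≤s; NonZero)
import Data.Nat as ℕ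
import Data.Nat.Properties as ℕ
open import Data.Nat.DivMod using (_/_; _mod_; m≡m%n+[m/n]*n; m%n<n; %-remove-+ˡ; m∣n⇒o%n%m≡o%m)
open import Data.Nat.Divisibility using (_∣_; divides; _∣0; ∣m∣n⇒∣m+n; ∣-refl)
open import Data.Fin as Fin using (Fin; toℕ)
import Data.Fin.Properties as Fin
open import Data.Bool using (Bool; true; false; _xor_)
open import Data.Bool.Properties using (xor-same)
open import Data.List using (List; []; _∷_; length; filter; map; tabulate; allFin)
open import Data.List.Properties using (length-filter; length-map; length-tabulate)
open import Data.List.Relation.Unary.All as All using ([]; _∷_)
open import Data.List.Relation.Unary.Any as Any using (here; there)
open import Data.List.Relation.Unary.AllPairs as AllPairs using ([]; _∷_)
open import Data.List.Relation.Unary.Unique.Propositional using (Unique)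
import Data.List.Relation.Unary.Unique.Propositional.Properties as Unique
open import Data.List.Membership.Propositional using (_∈_; lose)
open import Data.List.Membership.Propositional.Properties
  using (∈-filter⁺; ∈-filter⁻; ∈-map⁺; ∈-map⁻; ∈-tabulate⁺; ∈-allFin)
open import Data.List.Membership.Propositional.Properties.WithK using (unique∧set⇒bag)
open import Data.List.Relation.Binary.BagAndSetEquality using (∼bag⇒↭; _∼[_]_; set)
open import Data.List.Relation.Binary.Permutation.Propositional.Properties using (↭-length)
open import Data.Product using (_,_; proj₁; proj₂)
open import Data.Sum using (inj₁; inj₂)
open import Data.Empty using (⊥-elim)
open import Data.Unit using (tt)
open import Function using (id; _∘′_; case_of_)
open import Function.Bundles using (Inverse; Injection; mk⇔)
open import Function.Properties.Inverse using (↔-sym; Inverse⇒Injection)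
open import Algebra.Bundles using (CommutativeRing)
open import Relation.Unary using (Pred; Decidable; U)
open import Relation.Unary.Properties using (∁?; U?)
open import Relation.Nullary using (¬_; Dec; does; yes; no; ¬?)
open import Relation.Nullary.Decidable using (_×-dec_; decidable-stable; via-injection; map′)
open import Relation.Binary.Definitions using (DecidableEquality; tri<; tri≈; tri>)
open import Relation.Binary.PropositionalEquality
  using (refl; sym; trans; cong; cong₂; subst; module ≡-Reasoning)

-- Orbit counting

module _ {A : Set} where

  length-filter-∁ : ∀ {ℓ} {P : Pred A ℓ} (P? : Decidable P) xs →
    length (filter P? xs) ℕ.+ length (filter (∁? P?) xs) ≡ length xs
  length-filter-∁ P? [] = refl
  length-filter-∁ P? (x ∷ xs) with does (P? x)
  ... | true  = cong suc (length-filter-∁ P? xs)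
  ... | false = trans (ℕ.+-suc _ _) (cong suc (length-filter-∁ P? xs))

  unique-length-cong : ∀ {xs ys : List A} → Unique xs → Unique ys → xs ∼[ set ] ys →
    length xs ≡ length ys
  unique-length-cong !xs !ys xs≈ys = ↭-length (∼bag⇒↭ (unique∧set⇒bag !xs !ys xs≈ys))

-- Only the laws used to show that orbits partition P are required; G need not be a group.
record FreeAction {A : Set} (P : A → Set) : Set₁ where
  infixr 7 _·_
  field
    G : Set
    elements : List G
    elements-unique : Unique elements
    ∈-elements : ∀ g → g ∈ elements
    _·_ : G → A → A
    ·-closed : ∀ g {x} → P x → P (g · x)
    ε : G
    _∙_ : G → G → G
    _⁻¹ : G → G
    ε-· : ∀ {x} → P x → ε · x ≡ x
    ∙-· : ∀ g h {x} → P x → (g ∙ h) · x ≡ g · h · x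
    ⁻¹-· : ∀ g {x} → P x → g ⁻¹ · g · x ≡ x
    free : ∀ g h {x} → P x → g · x ≡ h · x → g ≡ h

  order : ℕ
  order = length elements

  orbit : A → List A
  orbit x = map (_· x) elements

  ∈-orbit : ∀ g x → g · x ∈ orbit x
  ∈-orbit g x = ∈-map⁺ (_· x) (∈-elements g)

  orbit-unique : ∀ {x} → P x → Unique (orbit x)
  orbit-unique Px = Unique.map⁺ (free _ _ Px) elements-unique

  orbit-length : ∀ x → length (orbit x) ≡ order
  orbit-length x = length-map (_· x) elements

  orbit-refl : ∀ {x} → P x → x ∈ orbit x
  orbit-refl {x} Px = subst (_∈ orbit x) (ε-· Px) (∈-orbit ε x)

  orbit-sym : ∀ {x y} → P x → y ∈ orbit x → x ∈ orbit y
  orbit-sym {x} Px y∈ with ∈-map⁻ (_· x) y∈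
  ... | g , _ , refl = subst (_∈ orbit (g · x)) (⁻¹-· g Px) (∈-orbit (g ⁻¹) (g · x))

  orbit-trans : ∀ {x y z} → P x → y ∈ orbit x → z ∈ orbit y → z ∈ orbit x
  orbit-trans {x} Px y∈ z∈ with ∈-map⁻ (_· x) y∈
  ... | g , _ , refl with ∈-map⁻ (_· (g · x)) z∈
  ... | h , _ , refl = subst (_∈ orbit x) (∙-· h g Px) (∈-orbit (h ∙ g) x)

  record InvariantSet (xs : List A) : Set where
    field
      unique : Unique xs
      all-P : ∀ {x} → x ∈ xs → P x
      closed : ∀ g {x} → x ∈ xs → g · x ∈ xs

  module _ (_≟_ : DecidableEquality A) where
    open import Data.List.Membership.DecPropositional _≟_ using (_∈?_)

    inside outside : A → List A → List A
    inside x = filter (_∈? orbit x)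
    outside x = filter (∁? (_∈? orbit x))

    module _ {x rest} (inv : InvariantSet (x ∷ rest)) where
      open InvariantSet inv

      private
        Px : P x
        Px = all-P (here refl)

        x∉rest = AllPairs.head unique

      outside-invariant : InvariantSet (outside x rest)
      outside-invariant = record
        { unique = Unique.filter⁺ (∁? (_∈? orbit x)) (AllPairs.tail unique)
        ; all-P = λ y∈ → all-P (there (proj₁ (∈-filter⁻ (∁? (_∈? orbit x)) {xs = rest} y∈)))
        ; closed = closed-outside
        }
        where
        closed-outside : ∀ g {y} → y ∈ outside x rest → g · y ∈ outside x rest
        closed-outside g {y} y∈ with ∈-filter⁻ (∁? (_∈? orbit x)) {xs = rest} y∈
        ... | y∈rest , y∉orbit with closed g (there y∈rest)
        ... | here refl = ⊥-elim (y∉orbit (orbit-sym (all-P (there y∈rest)) (∈-orbit g y)))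
        ... | there gy∈rest = ∈-filter⁺ (∁? (_∈? orbit x)) gy∈rest
          (λ gy∈orbit → y∉orbit (orbit-trans Px gy∈orbit (orbit-sym (all-P (there y∈rest)) (∈-orbit g y))))

      orbit≈x∷inside : (x ∷ inside x rest) ∼[ set ] orbit x
      orbit≈x∷inside = mk⇔ to from
        where
        to : ∀ {z} → z ∈ x ∷ inside x rest → z ∈ orbit x
        to (here refl) = orbit-refl Px
        to (there z∈) = proj₂ (∈-filter⁻ (_∈? orbit x) {xs = rest} z∈)
        from : ∀ {z} → z ∈ orbit x → z ∈ x ∷ inside x rest
        from z∈ with ∈-map⁻ (_· x) z∈
        ... | g , _ , refl with closed g (here refl)
        ... | here gx≡x = here gx≡x
        ... | there gx∈rest = there (∈-filter⁺ (_∈? orbit x) gx∈rest z∈)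

      order+|outside|≡length : order ℕ.+ length (outside x rest) ≡ length (x ∷ rest)
      order+|outside|≡length = begin
        order ℕ.+ length (outside x rest)                      ≡⟨ cong (ℕ._+ length (outside x rest)) (sym (orbit-length x)) ⟩
        length (orbit x) ℕ.+ length (outside x rest)           ≡⟨ cong (ℕ._+ length (outside x rest)) (sym |x∷inside|≡|orbit|) ⟩
        suc (length (inside x rest) ℕ.+ length (outside x rest)) ≡⟨ cong suc (length-filter-∁ (_∈? orbit x) rest) ⟩
        length (x ∷ rest)                                      ∎
        where
        open ≡-Reasoning
        !x∷inside : Unique (x ∷ inside x rest)
        !x∷inside = All.tabulate (λ z∈ → All.lookup x∉rest (proj₁ (∈-filter⁻ (_∈? orbit x) {xs = rest} z∈)))
                    ∷ Unique.filter⁺ (_∈? orbit x) (AllPairs.tail unique)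
        |x∷inside|≡|orbit| = unique-length-cong !x∷inside (orbit-unique Px) orbit≈x∷inside

    -- Removing the orbit of the head leaves a smaller invariant set.
    order-∣-invariant : ∀ {xs} → InvariantSet xs → order ∣ length xs
    order-∣-invariant {xs} = go (length xs) ℕ.≤-refl
      where
      go : ∀ {xs} n → length xs ≤ n → InvariantSet xs → order ∣ length xs
      go {[]} _ _ _ = order ∣0
      go {x ∷ rest} (suc n) (s≤s |rest|≤n) inv = subst (order ∣_) (order+|outside|≡length inv)
        (∣m∣n⇒∣m+n ∣-refl (go n (ℕ.≤-trans (length-filter _ rest) |rest|≤n) (outside-invariant inv)))

-- Arithmetic in F_q

module Field {q : ℕ} (F : FiniteField q) where
  open FiniteField F
  open JGraph F using (two; IsSquare)
  open ≡-Reasoning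

  commutativeRing : CommutativeRing 0ℓ 0ℓ
  commutativeRing = record { isCommutativeRing = isCommutativeRing }

  open CommutativeRing commutativeRing public
    using ( +-assoc; +-identityʳ; -‿inverseʳ; distribʳ
          ; *-assoc; *-comm; *-identityˡ; *-identityʳ; zeroˡ; zeroʳ
          ; ring; commutativeSemiring; *-commutativeSemigroup)
  open import Algebra.Properties.Ring ring public
    using (-‿involutive; -‿injective; -0#≈0#; -‿distribˡ-*; -‿distribʳ-*; -1*x≈-x
          ; +-cancelˡ; +-cancelʳ; +-inverseˡ-unique; +-identityˡ-unique; //-rightDividesˡ; x∙y⁻¹≈ε⇒x≈y)
  open import Algebra.Properties.CommutativeSemigroup *-commutativeSemigroup public
    using (interchange)
  open import Algebra.Solver.Ring.NaturalCoefficients.Default commutativeSemiring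
    using (solve; _:+_; _:*_; _:=_)
  open import Algebra.Properties.CommutativeSemiring.Exp commutativeSemiring public
    using (_^_; ^-assocʳ; ^-homo-*; ^-distrib-*)

  infix 4 _≟_
  _≟_ : DecidableEquality Carrier
  _≟_ = via-injection (Inverse⇒Injection (↔-sym enumeration)) Fin._≟_

  x⁻¹*x≡1 : ∀ {x} → x ≢ 0# → x ⁻¹ * x ≡ 1#
  x⁻¹*x≡1 {x} x≢0 = trans (*-comm (x ⁻¹) x) (inverseʳ x x≢0)

  *-cancelˡ : ∀ {x} y z → x ≢ 0# → x * y ≡ x * z → y ≡ z
  *-cancelˡ {x} y z x≢0 xy≡xz = begin
    y                  ≡⟨ sym (*-identityˡ y) ⟩
    1# * y             ≡⟨ cong (_* y) (sym (x⁻¹*x≡1 x≢0)) ⟩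
    (x ⁻¹ * x) * y     ≡⟨ *-assoc (x ⁻¹) x y ⟩
    x ⁻¹ * (x * y)     ≡⟨ cong (x ⁻¹ *_) xy≡xz ⟩
    x ⁻¹ * (x * z)     ≡⟨ sym (*-assoc (x ⁻¹) x z) ⟩
    (x ⁻¹ * x) * z     ≡⟨ cong (_* z) (x⁻¹*x≡1 x≢0) ⟩
    1# * z             ≡⟨ *-identityˡ z ⟩
    z                  ∎

  x*y≢0 : ∀ {x y} → x ≢ 0# → y ≢ 0# → x * y ≢ 0#
  x*y≢0 {x} {y} x≢0 y≢0 xy≡0 = y≢0 (*-cancelˡ y 0# x≢0 (trans xy≡0 (sym (zeroʳ x))))

  x*y≡0⇒x≡0⊎y≡0 : ∀ x y → x * y ≡ 0# → x ≡ 0# ⊎ y ≡ 0#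
  x*y≡0⇒x≡0⊎y≡0 x y xy≡0 with x ≟ 0# | y ≟ 0#
  ... | yes x≡0 | _     = inj₁ x≡0
  ... | no _    | yes y≡0 = inj₂ y≡0
  ... | no x≢0  | no y≢0  = ⊥-elim (x*y≢0 x≢0 y≢0 xy≡0)

  x⁻¹≢0 : ∀ {x} → x ≢ 0# → x ⁻¹ ≢ 0#
  x⁻¹≢0 {x} x≢0 x⁻¹≡0 = 0≢1 (begin
    0#           ≡⟨ sym (zeroʳ x) ⟩
    x * 0#       ≡⟨ cong (x *_) (sym x⁻¹≡0) ⟩
    x * x ⁻¹     ≡⟨ inverseʳ x x≢0 ⟩
    1#           ∎)

  ⁻¹-unique : ∀ {x y} → x ≢ 0# → x * y ≡ 1# → y ≡ x ⁻¹
  ⁻¹-unique {x} {y} x≢0 xy≡1 = *-cancelˡ y (x ⁻¹) x≢0 (trans xy≡1 (sym (inverseʳ x x≢0)))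

  ⁻¹-involutive : ∀ {x} → x ≢ 0# → x ⁻¹ ⁻¹ ≡ x
  ⁻¹-involutive {x} x≢0 = sym (⁻¹-unique (x⁻¹≢0 x≢0) (x⁻¹*x≡1 x≢0))

  1≢0 : 1# ≢ 0#
  1≢0 1≡0 = 0≢1 (sym 1≡0)

  0≢-1 : 0# ≢ - 1#
  0≢-1 0≡-1 = 0≢1 (trans (sym -0#≈0#) (trans (cong -_ 0≡-1) (-‿involutive 1#)))

  1⁻¹≡1 : 1# ⁻¹ ≡ 1#
  1⁻¹≡1 = sym (⁻¹-unique 1≢0 (*-identityˡ 1#))

  x⁻¹≡y⇒x≡y : ∀ {x y} → x ≢ 0# → x ⁻¹ ≡ y → y ⁻¹ ≡ y → x ≡ y
  x⁻¹≡y⇒x≡y {x} x≢0 x⁻¹≡y y⁻¹≡y = trans (sym (⁻¹-involutive x≢0)) (trans (cong _⁻¹ x⁻¹≡y) y⁻¹≡y)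

  -x≢0 : ∀ {x} → x ≢ 0# → - x ≢ 0#
  -x≢0 {x} x≢0 -x≡0 = x≢0 (trans (sym (-‿involutive x)) (trans (cong -_ -x≡0) -0#≈0#))

  -‿⁻¹ : ∀ {x} → x ≢ 0# → (- x) ⁻¹ ≡ - (x ⁻¹)
  -‿⁻¹ {x} x≢0 = sym (⁻¹-unique (-x≢0 x≢0) (begin
    - x * - (x ⁻¹)      ≡⟨ sym (-‿distribˡ-* x (- (x ⁻¹))) ⟩
    - (x * - (x ⁻¹))    ≡⟨ cong -_ (sym (-‿distribʳ-* x (x ⁻¹))) ⟩
    - - (x * x ⁻¹)      ≡⟨ -‿involutive (x * x ⁻¹) ⟩
    x * x ⁻¹            ≡⟨ inverseʳ x x≢0 ⟩
    1#                  ∎))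

  -1⁻¹≡-1 : (- 1#) ⁻¹ ≡ - 1#
  -1⁻¹≡-1 = trans (-‿⁻¹ 1≢0) (cong -_ 1⁻¹≡1)

  -x*-y≡x*y : ∀ x y → - x * - y ≡ x * y
  -x*-y≡x*y x y = begin
    - x * - y        ≡⟨ sym (-‿distribˡ-* x (- y)) ⟩
    - (x * - y)      ≡⟨ cong -_ (sym (-‿distribʳ-* x y)) ⟩
    - - (x * y)      ≡⟨ -‿involutive (x * y) ⟩
    x * y            ∎

  two*x≡x+x : ∀ x → two * x ≡ x + x
  two*x≡x+x x = trans (distribʳ x 1# 1#) (cong₂ _+_ (*-identityˡ x) (*-identityˡ x))

  x≡-x⇒x≡0 : two ≢ 0# → ∀ {x} → x ≡ - x → x ≡ 0#
  x≡-x⇒x≡0 two≢0 {x} x≡-x with x*y≡0⇒x≡0⊎y≡0 two x two*x≡0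
    where
    two*x≡0 : two * x ≡ 0#
    two*x≡0 = begin
      two * x    ≡⟨ two*x≡x+x x ⟩
      x + x      ≡⟨ cong (x +_) x≡-x ⟩
      x + - x    ≡⟨ -‿inverseʳ x ⟩
      0#         ∎
  ... | inj₁ two≡0 = ⊥-elim (two≢0 two≡0)
  ... | inj₂ x≡0   = x≡0

  1≢-1 : two ≢ 0# → 1# ≢ - 1#
  1≢-1 two≢0 1≡-1 = 0≢1 (sym (x≡-x⇒x≡0 two≢0 1≡-1))

  -- The solver only knows semirings, so substitute x = u + y with u = x - y.
  x*x≡[x-y]*[x+y]+y*y : ∀ x y → x * x ≡ (x + - y) * (x + y) + y * y
  x*x≡[x-y]*[x+y]+y*y x y = begin
    x * x                        ≡⟨ cong (λ z → z * z) (sym x-y+y≡x) ⟩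
    (u + y) * (u + y)            ≡⟨ solve 2 (λ u y → (u :+ y) :* (u :+ y) := u :* ((u :+ y) :+ y) :+ y :* y) refl u y ⟩
    u * ((u + y) + y) + y * y    ≡⟨ cong (λ z → u * (z + y) + y * y) x-y+y≡x ⟩
    u * (x + y) + y * y          ∎
    where
    u = x + - y
    x-y+y≡x = //-rightDividesˡ y x

  x*x≡y*y⇒x≡y⊎x≡-y : ∀ {x y} → x * x ≡ y * y → x ≡ y ⊎ x ≡ - y
  x*x≡y*y⇒x≡y⊎x≡-y {x} {y} xx≡yy with x*y≡0⇒x≡0⊎y≡0 (x + - y) (x + y) product≡0
    where
    product≡0 = +-identityˡ-unique _ (y * y) (trans (sym (x*x≡[x-y]*[x+y]+y*y x y)) xx≡yy)
  ... | inj₁ x-y≡0 = inj₁ (x∙y⁻¹≈ε⇒x≈y x y x-y≡0)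
  ... | inj₂ x+y≡0 = inj₂ (+-inverseˡ-unique x y x+y≡0)

  -- As above, substitute a = u + b with u = a - b.
  [a+b]²w²≡[a-b]²w²+ab : ∀ {w} → two * w ≡ 1# → ∀ a b →
    ((a + b) * w) * ((a + b) * w) ≡ ((a + - b) * w) * ((a + - b) * w) + a * b
  [a+b]²w²≡[a-b]²w²+ab {w} two*w≡1 a b = begin
    ((a + b) * w) * ((a + b) * w)
      ≡⟨ cong (λ z → ((z + b) * w) * ((z + b) * w)) (sym a-b+b≡a) ⟩
    ((u + b + b) * w) * ((u + b + b) * w)
      ≡⟨ solve 3 (λ u b w → ((u :+ b :+ b) :* w) :* ((u :+ b :+ b) :* w)
                        := (u :* w) :* (u :* w) :+ ((u :+ b) :* b) :* ((w :+ w) :* (w :+ w))) refl u b w ⟩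
    (u * w) * (u * w) + ((u + b) * b) * ((w + w) * (w + w))
      ≡⟨ cong₂ (λ z v → (u * w) * (u * w) + (z * b) * (v * v)) a-b+b≡a w+w≡1 ⟩
    (u * w) * (u * w) + (a * b) * (1# * 1#)
      ≡⟨ cong (λ z → (u * w) * (u * w) + (a * b) * z) (*-identityˡ 1#) ⟩
    (u * w) * (u * w) + (a * b) * 1#
      ≡⟨ cong ((u * w) * (u * w) +_) (*-identityʳ (a * b)) ⟩
    (u * w) * (u * w) + a * b
      ∎
    where
    u = a + - b
    a-b+b≡a = //-rightDividesˡ b a
    w+w≡1 = trans (sym (two*x≡x+x w)) two*w≡1

  [x*y]²≡x²*y² : ∀ x y → (x * y) * (x * y) ≡ (x * x) * (y * y)
  [x*y]²≡x²*y² x y = interchange x y x y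

  IsSquare-* : ∀ {x y} → IsSquare x → IsSquare y → IsSquare (x * y)
  IsSquare-* (u , uu≡x) (v , vv≡y) = u * v , trans ([x*y]²≡x²*y² u v) (cong₂ _*_ uu≡x vv≡y)

  IsSquare-cancelˡ : ∀ {x y} → x ≢ 0# → IsSquare x → IsSquare (x * y) → IsSquare y
  IsSquare-cancelˡ {x} {y} x≢0 (u , uu≡x) (v , vv≡xy) = v * u ⁻¹ , (begin
    (v * u ⁻¹) * (v * u ⁻¹)              ≡⟨ [x*y]²≡x²*y² v (u ⁻¹) ⟩
    (v * v) * (u ⁻¹ * u ⁻¹)              ≡⟨ cong (_* (u ⁻¹ * u ⁻¹)) (trans vv≡xy (cong (_* y) (sym uu≡x))) ⟩
    ((u * u) * y) * (u ⁻¹ * u ⁻¹)        ≡⟨ cong (_* (u ⁻¹ * u ⁻¹)) (*-comm (u * u) y) ⟩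
    (y * (u * u)) * (u ⁻¹ * u ⁻¹)        ≡⟨ *-assoc y (u * u) (u ⁻¹ * u ⁻¹) ⟩
    y * ((u * u) * (u ⁻¹ * u ⁻¹))        ≡⟨ cong (y *_) (interchange u u (u ⁻¹) (u ⁻¹)) ⟩
    y * ((u * u ⁻¹) * (u * u ⁻¹))        ≡⟨ cong (λ z → y * (z * z)) (inverseʳ u u≢0) ⟩
    y * (1# * 1#)                        ≡⟨ cong (y *_) (*-identityˡ 1#) ⟩
    y * 1#                               ≡⟨ *-identityʳ y ⟩
    y                                    ∎)
    where
    u≢0 : u ≢ 0#
    u≢0 u≡0 = x≢0 (trans (sym uu≡x) (trans (cong (_* u) u≡0) (zeroˡ u)))

  1^n≡1 : ∀ n → 1# ^ n ≡ 1#
  1^n≡1 zero    = refl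
  1^n≡1 (suc n) = trans (*-identityˡ (1# ^ n)) (1^n≡1 n)

  x^4≡[x*x]*[x*x] : ∀ x → x ^ 4 ≡ (x * x) * (x * x)
  x^4≡[x*x]*[x*x] x = trans (sym (^-assocʳ x 2 2)) (trans x^2≡x*x (cong₂ _*_ x^2≡x*x x^2≡x*x))
    where
    x^2≡x*x : ∀ {y} → y ^ 2 ≡ y * y
    x^2≡x*x {y} = cong (y *_) (*-identityʳ y)

  ^4-quotient : ∀ {m t} → t ≢ 0# → m ^ 4 ≡ - (t ^ 4) → (m * t ⁻¹) ^ 4 ≡ - 1#
  ^4-quotient {m} {t} t≢0 m⁴≡-t⁴ = begin
    (m * t ⁻¹) ^ 4                ≡⟨ ^-distrib-* m (t ⁻¹) 4 ⟩
    m ^ 4 * (t ⁻¹) ^ 4            ≡⟨ cong (_* (t ⁻¹) ^ 4) m⁴≡-t⁴ ⟩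
    - (t ^ 4) * (t ⁻¹) ^ 4        ≡⟨ sym (-‿distribˡ-* (t ^ 4) ((t ⁻¹) ^ 4)) ⟩
    - (t ^ 4 * (t ⁻¹) ^ 4)        ≡⟨ cong -_ (sym (^-distrib-* t (t ⁻¹) 4)) ⟩
    - ((t * t ⁻¹) ^ 4)            ≡⟨ cong (λ z → - (z ^ 4)) (inverseʳ t t≢0) ⟩
    - (1# ^ 4)                    ≡⟨ cong -_ (1^n≡1 4) ⟩
    - 1#                          ∎

  [c-d][c+d]≡[[a-b]w]² : ∀ {w} → two * w ≡ 1# → ∀ {a b c d} → c ≡ (a + b) * w → d * d ≡ a * b →
    (c + - d) * (c + d) ≡ ((a + - b) * w) * ((a + - b) * w)
  [c-d][c+d]≡[[a-b]w]² {w} two*w≡1 {a} {b} {c} {d} c≡ dd≡ab = +-cancelʳ (d * d) _ _ (begin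
    (c + - d) * (c + d) + d * d                    ≡⟨ sym (x*x≡[x-y]*[x+y]+y*y c d) ⟩
    c * c                                          ≡⟨ cong (λ z → z * z) c≡ ⟩
    ((a + b) * w) * ((a + b) * w)                  ≡⟨ [a+b]²w²≡[a-b]²w²+ab two*w≡1 a b ⟩
    ((a + - b) * w) * ((a + - b) * w) + a * b      ≡⟨ cong (((a + - b) * w) * ((a + - b) * w) +_) (sym dd≡ab) ⟩
    ((a + - b) * w) * ((a + - b) * w) + d * d      ∎)

  elements : List Carrier
  elements = tabulate (Inverse.to enumeration)

  elements-unique : Unique elements
  elements-unique = Unique.tabulate⁺ (Injection.injective (Inverse⇒Injection enumeration))

  ∈-elements : ∀ x → x ∈ elements
  ∈-elements x = subst (_∈ elements) (Inverse.strictlyInverseˡ enumeration x)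
    (∈-tabulate⁺ (Inverse.from enumeration x))

  length-elements : length elements ≡ q
  length-elements = length-tabulate (Inverse.to enumeration)

  isSquare? : Decidable IsSquare
  isSquare? x = map′ Any.satisfied (λ (b , bb≡x) → lose (∈-elements b) bb≡x) (Any.any? (λ b → b * b ≟ x) elements)

  length-filter-elements : ∀ {P : Carrier → Set} (P? : Decidable P) (¬P : List Carrier) →
    Unique ¬P → (∀ {x} → ¬ P x → x ∈ ¬P) → (∀ {x} → x ∈ ¬P → ¬ P x) →
    length (filter P? elements) ℕ.+ length ¬P ≡ q
  length-filter-elements P? ¬P !¬P ¬P⇒∈ ∈⇒¬P = begin
    length (filter P? elements) ℕ.+ length ¬P
      ≡⟨ cong (length (filter P? elements) ℕ.+_) (unique-length-cong !¬P (Unique.filter⁺ (∁? P?) elements-unique) (mk⇔ to from)) ⟩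
    length (filter P? elements) ℕ.+ length (filter (∁? P?) elements)
      ≡⟨ length-filter-∁ P? elements ⟩
    length elements
      ≡⟨ length-elements ⟩
    q ∎
    where
    to : ∀ {x} → x ∈ ¬P → x ∈ filter (∁? P?) elements
    to {x} x∈ = ∈-filter⁺ (∁? P?) (∈-elements x) (∈⇒¬P x∈)
    from : ∀ {x} → x ∈ filter (∁? P?) elements → x ∈ ¬P
    from x∈ = ¬P⇒∈ (proj₂ (∈-filter⁻ (∁? P?) {xs = elements} x∈))

  q%d≡|¬P|%d : ∀ {P : Carrier → Set} (act : FreeAction P) (P? : Decidable P) {d} .{{_ : NonZero d}} →
    FreeAction.order act ≡ d → (¬P : List Carrier) → Unique ¬P →
    (∀ {x} → ¬ P x → x ∈ ¬P) → (∀ {x} → x ∈ ¬P → ¬ P x) → q % d ≡ length ¬P % d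
  q%d≡|¬P|%d act P? {d} order≡d ¬P !¬P ¬P⇒∈ ∈⇒¬P = begin
    q % d                                                ≡⟨ cong (_% d) (sym (length-filter-elements P? ¬P !¬P ¬P⇒∈ ∈⇒¬P)) ⟩
    (length (filter P? elements) ℕ.+ length ¬P) % d      ≡⟨ %-remove-+ˡ (length ¬P) (subst (_∣ _) order≡d order∣) ⟩
    length ¬P % d                                        ∎
    where
    open FreeAction act using (order; order-∣-invariant; ·-closed)
    order∣ : order ∣ length (filter P? elements)
    order∣ = order-∣-invariant _≟_ record
      { unique = Unique.filter⁺ P? elements-unique
      ; all-P = λ x∈ → proj₂ (∈-filter⁻ P? {xs = elements} x∈)
      ; closed = λ g x∈ → ∈-filter⁺ P? (∈-elements _) (·-closed g (proj₂ (∈-filter⁻ P? {xs = elements} x∈)))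
      }

-- The residue of q modulo 2, 4 and 8

module Counting {q : ℕ} (F : FiniteField q) where
  open FiniteField F
  open JGraph F using (two; IsSquare)
  open Field F
  open ≡-Reasoning

  module Translation (two≡0 : two ≡ 0#) where

    _·_ : Bool → Carrier → Carrier
    false · x = x
    true  · x = x + 1#

    x+1+1≡x : ∀ x → (x + 1#) + 1# ≡ x
    x+1+1≡x x = trans (+-assoc x 1# 1#) (trans (cong (x +_) two≡0) (+-identityʳ x))

    x≢x+1 : ∀ x → x ≢ x + 1#
    x≢x+1 x x≡x+1 = 0≢1 (+-cancelˡ x 0# 1# (trans (+-identityʳ x) x≡x+1))

    action : FreeAction U
    action = record
      { G = Bool ; elements = false ∷ true ∷ [] ; elements-unique = ((λ ()) ∷ []) ∷ [] ∷ []
      ; ∈-elements = λ { false → here refl ; true → there (here refl) }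
      ; _·_ = _·_ ; ·-closed = _ ; ε = false ; _∙_ = _xor_ ; _⁻¹ = id
      ; ε-· = λ _ → refl
      ; ∙-· = λ { false _ _ → refl ; true false _ → refl ; true true {x} _ → sym (x+1+1≡x x) }
      ; ⁻¹-· = λ { false _ → refl ; true {x} _ → x+1+1≡x x }
      ; free = λ { false false _ _ → refl ; true true _ _ → refl
                 ; false true {x} _ eq → ⊥-elim (x≢x+1 x eq)
                 ; true false {x} _ eq → ⊥-elim (x≢x+1 x (sym eq)) }
      }

  two≡0⇒q%2≡0 : two ≡ 0# → q % 2 ≡ 0
  two≡0⇒q%2≡0 two≡0 = q%d≡|¬P|%d (Translation.action two≡0) U? refl [] [] (λ ¬⊤ → ⊥-elim (¬⊤ tt)) (λ ())

  negateIf : Bool → Carrier → Carrier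
  negateIf false x = x
  negateIf true  x = - x

  invertIf : Bool → Carrier → Carrier
  invertIf false x = x
  invertIf true  x = x ⁻¹

  negateIf-xor : ∀ a c x → negateIf (a xor c) x ≡ negateIf a (negateIf c x)
  negateIf-xor false c     x = refl
  negateIf-xor true  false x = refl
  negateIf-xor true  true  x = sym (-‿involutive x)

  invertIf-xor : ∀ b d {x} → x ≢ 0# → invertIf (b xor d) x ≡ invertIf b (invertIf d x)
  invertIf-xor false d     _   = refl
  invertIf-xor true  false _   = refl
  invertIf-xor true  true  x≢0 = sym (⁻¹-involutive x≢0)

  invertIf-negateIf : ∀ b c {x} → x ≢ 0# → invertIf b (negateIf c x) ≡ negateIf c (invertIf b x)
  invertIf-negateIf false c     _   = refl
  invertIf-negateIf true  false _   = refl
  invertIf-negateIf true  true  x≢0 = -‿⁻¹ x≢0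

  invertIf-≢0 : ∀ b {x} → x ≢ 0# → invertIf b x ≢ 0#
  invertIf-≢0 false x≢0 = x≢0
  invertIf-≢0 true  x≢0 = x⁻¹≢0 x≢0

  xor≡false⇒≡ : ∀ a b → a xor b ≡ false → a ≡ b
  xor≡false⇒≡ false false _ = refl
  xor≡false⇒≡ true  true  _ = refl
  xor≡false⇒≡ false true  ()
  xor≡false⇒≡ true  false ()

  ∉0±1 : Carrier → Set
  ∉0±1 x = x ≢ 0# × x ≢ 1# × x ≢ - 1#

  ∉0±1? : ∀ x → Dec (∉0±1 x)
  ∉0±1? x = ¬? (x ≟ 0#) ×-dec ¬? (x ≟ 1#) ×-dec ¬? (x ≟ - 1#)

  ∉0±1-negateIf : ∀ a {x} → ∉0±1 x → ∉0±1 (negateIf a x)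
  ∉0±1-negateIf false x∉ = x∉
  ∉0±1-negateIf true {x} (x≢0 , x≢1 , x≢-1) =
    -x≢0 x≢0 ,
    (λ -x≡1 → x≢-1 (trans (sym (-‿involutive x)) (cong -_ -x≡1))) ,
    (λ -x≡-1 → x≢1 (-‿injective -x≡-1))

  ∉0±1-invertIf : ∀ b {x} → ∉0±1 x → ∉0±1 (invertIf b x)
  ∉0±1-invertIf false x∉ = x∉
  ∉0±1-invertIf true {x} (x≢0 , x≢1 , x≢-1) =
    x⁻¹≢0 x≢0 ,
    (λ x⁻¹≡1 → x≢1 (x⁻¹≡y⇒x≡y x≢0 x⁻¹≡1 1⁻¹≡1)) ,
    (λ x⁻¹≡-1 → x≢-1 (x⁻¹≡y⇒x≡y x≢0 x⁻¹≡-1 -1⁻¹≡-1))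

  module Klein (two≢0 : two ≢ 0#) (-1∉squares : ¬ IsSquare (- 1#)) where

    G : Set
    G = Bool × Bool

    _·_ : G → Carrier → Carrier
    (a , b) · x = negateIf a (invertIf b x)

    _∙_ : G → G → G
    (a , b) ∙ (c , d) = (a xor c , b xor d)

    ε : G
    ε = (false , false)

    ∙-· : ∀ g h {x} → ∉0±1 x → (g ∙ h) · x ≡ g · (h · x)
    ∙-· (a , b) (c , d) {x} (x≢0 , _) = begin
      negateIf (a xor c) (invertIf (b xor d) x)               ≡⟨ negateIf-xor a c _ ⟩
      negateIf a (negateIf c (invertIf (b xor d) x))          ≡⟨ cong (negateIf a ∘′ negateIf c) (invertIf-xor b d x≢0) ⟩
      negateIf a (negateIf c (invertIf b (invertIf d x)))     ≡⟨ cong (negateIf a) (sym (invertIf-negateIf b c (invertIf-≢0 d x≢0))) ⟩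
      negateIf a (invertIf b (negateIf c (invertIf d x)))     ∎

    g∙g≡ε : ∀ g → g ∙ g ≡ ε
    g∙g≡ε (a , b) = cong₂ _,_ (xor-same a) (xor-same b)

    g·g·x≡x : ∀ g {x} → ∉0±1 x → g · (g · x) ≡ x
    g·g·x≡x g {x} x∉ = trans (sym (∙-· g g x∉)) (cong (_· x) (g∙g≡ε g))

    stabilizer-trivial : ∀ g {x} → ∉0±1 x → g · x ≡ x → g ≡ ε
    stabilizer-trivial (false , false) _ _ = refl
    stabilizer-trivial (true , false) (x≢0 , _) -x≡x = ⊥-elim (x≢0 (x≡-x⇒x≡0 two≢0 (sym -x≡x)))
    stabilizer-trivial (false , true) {x} (x≢0 , x≢1 , x≢-1) x⁻¹≡x
      with x*x≡y*y⇒x≡y⊎x≡-y (trans (cong (x *_) (sym x⁻¹≡x)) (trans (inverseʳ x x≢0) (sym (*-identityˡ 1#))))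
    ... | inj₁ x≡1  = ⊥-elim (x≢1 x≡1)
    ... | inj₂ x≡-1 = ⊥-elim (x≢-1 x≡-1)
    stabilizer-trivial (true , true) {x} (x≢0 , _) -x⁻¹≡x = ⊥-elim (-1∉squares (x , (begin
      x * x              ≡⟨ cong (x *_) (sym -x⁻¹≡x) ⟩
      x * - (x ⁻¹)       ≡⟨ sym (-‿distribʳ-* x (x ⁻¹)) ⟩
      - (x * x ⁻¹)       ≡⟨ cong -_ (inverseʳ x x≢0) ⟩
      - 1#               ∎)))

    free : ∀ g h {x} → ∉0±1 x → g · x ≡ h · x → g ≡ h
    free (a , b) (c , d) {x} x∉ gx≡hx with stabilizer-trivial ((c , d) ∙ (a , b)) x∉ (begin
      ((c , d) ∙ (a , b)) · x    ≡⟨ ∙-· (c , d) (a , b) x∉ ⟩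
      (c , d) · ((a , b) · x)    ≡⟨ cong ((c , d) ·_) gx≡hx ⟩
      (c , d) · ((c , d) · x)    ≡⟨ g·g·x≡x (c , d) x∉ ⟩
      x                          ∎)
    ... | hg≡ε = sym (cong₂ _,_ (xor≡false⇒≡ c a (cong proj₁ hg≡ε)) (xor≡false⇒≡ d b (cong proj₂ hg≡ε)))

    action : FreeAction ∉0±1
    action = record
      { G = G
      ; elements = (false , false) ∷ (false , true) ∷ (true , false) ∷ (true , true) ∷ []
      ; elements-unique = ((λ ()) ∷ (λ ()) ∷ (λ ()) ∷ []) ∷ ((λ ()) ∷ (λ ()) ∷ []) ∷ ((λ ()) ∷ []) ∷ [] ∷ []
      ; ∈-elements = λ { (false , false) → here refl ; (false , true) → there (here refl)
                       ; (true , false) → there (there (here refl)) ; (true , true) → there (there (there (here refl))) }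
      ; _·_ = _·_ ; ·-closed = λ (a , b) x∉ → ∉0±1-negateIf a (∉0±1-invertIf b x∉)
      ; ε = ε ; _∙_ = _∙_ ; _⁻¹ = λ g → g
      ; ε-· = λ _ → refl ; ∙-· = ∙-· ; ⁻¹-· = g·g·x≡x ; free = free
      }

  0±1-unique : two ≢ 0# → Unique (0# ∷ 1# ∷ - 1# ∷ [])
  0±1-unique two≢0 = (0≢1 ∷ 0≢-1 ∷ []) ∷ (1≢-1 two≢0 ∷ []) ∷ [] ∷ []

  ¬∉0±1⇒∈0±1 : ∀ {x} → ¬ ∉0±1 x → x ∈ 0# ∷ 1# ∷ - 1# ∷ []
  ¬∉0±1⇒∈0±1 {x} ¬x∉ with x ≟ 0# | x ≟ 1# | x ≟ - 1#
  ... | yes x≡0 | _       | _        = here x≡0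
  ... | no _    | yes x≡1 | _        = there (here x≡1)
  ... | no _    | no _    | yes x≡-1 = there (there (here x≡-1))
  ... | no x≢0  | no x≢1  | no x≢-1  = ⊥-elim (¬x∉ (x≢0 , x≢1 , x≢-1))

  ∈0±1⇒¬∉0±1 : ∀ {x} → x ∈ 0# ∷ 1# ∷ - 1# ∷ [] → ¬ ∉0±1 x
  ∈0±1⇒¬∉0±1 (here refl)                 (x≢0 , _)      = x≢0 refl
  ∈0±1⇒¬∉0±1 (there (here refl))         (_ , x≢1 , _)  = x≢1 refl
  ∈0±1⇒¬∉0±1 (there (there (here refl))) (_ , _ , x≢-1) = x≢-1 refl

  -1∉squares⇒q%4≡3 : two ≢ 0# → ¬ IsSquare (- 1#) → q % 4 ≡ 3
  -1∉squares⇒q%4≡3 two≢0 -1∉squares = q%d≡|¬P|%d (Klein.action two≢0 -1∉squares) ∉0±1? refl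
    (0# ∷ 1# ∷ - 1# ∷ []) (0±1-unique two≢0) ¬∉0±1⇒∈0±1 ∈0±1⇒¬∉0±1

  module Cyclic {g : Carrier} {n : ℕ} .{{_ : NonZero n}} (gⁿ≡1 : g ^ n ≡ 1#) where

    g^m≡g^[m%n] : ∀ m → g ^ m ≡ g ^ (m % n)
    g^m≡g^[m%n] m = begin
      g ^ m                             ≡⟨ cong (g ^_) (m≡m%n+[m/n]*n m n) ⟩
      g ^ (m % n ℕ.+ (m / n) ℕ.* n)     ≡⟨ ^-homo-* g (m % n) _ ⟩
      g ^ (m % n) * g ^ ((m / n) ℕ.* n) ≡⟨ cong (λ k → g ^ (m % n) * g ^ k) (ℕ.*-comm (m / n) n) ⟩
      g ^ (m % n) * g ^ (n ℕ.* (m / n)) ≡⟨ cong (g ^ (m % n) *_) (sym (^-assocʳ g n (m / n))) ⟩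
      g ^ (m % n) * (g ^ n) ^ (m / n)   ≡⟨ cong (λ y → g ^ (m % n) * y ^ (m / n)) gⁿ≡1 ⟩
      g ^ (m % n) * 1# ^ (m / n)        ≡⟨ cong (g ^ (m % n) *_) (1^n≡1 (m / n)) ⟩
      g ^ (m % n) * 1#                  ≡⟨ *-identityʳ _ ⟩
      g ^ (m % n)                       ∎

    g^j≢0 : ∀ {j} → j ℕ.≤ n → g ^ j ≢ 0#
    g^j≢0 {j} j≤n g^j≡0 = 0≢1 (begin
      0#                     ≡⟨ sym (zeroˡ (g ^ (n ∸ j))) ⟩
      0# * g ^ (n ∸ j)       ≡⟨ cong (_* g ^ (n ∸ j)) (sym g^j≡0) ⟩
      g ^ j * g ^ (n ∸ j)    ≡⟨ sym (^-homo-* g j (n ∸ j)) ⟩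
      g ^ (j ℕ.+ (n ∸ j))    ≡⟨ cong (g ^_) (ℕ.m+[n∸m]≡n j≤n) ⟩
      g ^ n                  ≡⟨ gⁿ≡1 ⟩
      1#                     ∎)

    module _ (g^k≢1 : ∀ k → 0 < k → k < n → g ^ k ≢ 1#) where

      g^j≢g^k : ∀ {j k} → j < k → k < n → g ^ j ≢ g ^ k
      g^j≢g^k {j} {k} j<k k<n g^j≡g^k = g^k≢1 (k ∸ j) (ℕ.m<n⇒0<n∸m j<k) (ℕ.≤-<-trans (ℕ.m∸n≤m k j) k<n)
        (*-cancelˡ (g ^ (k ∸ j)) 1# (g^j≢0 (ℕ.<⇒≤ (ℕ.<-trans j<k k<n))) (begin
          g ^ j * g ^ (k ∸ j)    ≡⟨ sym (^-homo-* g j (k ∸ j)) ⟩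
          g ^ (j ℕ.+ (k ∸ j))    ≡⟨ cong (g ^_) (ℕ.m+[n∸m]≡n (ℕ.<⇒≤ j<k)) ⟩
          g ^ k                  ≡⟨ sym g^j≡g^k ⟩
          g ^ j                  ≡⟨ sym (*-identityʳ (g ^ j)) ⟩
          g ^ j * 1#             ∎))

      ^-injective : ∀ {j k} → j < n → k < n → g ^ j ≡ g ^ k → j ≡ k
      ^-injective {j} {k} j<n k<n g^j≡g^k with ℕ.<-cmp j k
      ... | tri< j<k _ _ = ⊥-elim (g^j≢g^k j<k k<n g^j≡g^k)
      ... | tri≈ _ j≡k _ = j≡k
      ... | tri> _ _ k<j = ⊥-elim (g^j≢g^k k<j j<n (sym g^j≡g^k))

      _·_ : Fin n → Carrier → Carrier
      k · x = g ^ toℕ k * x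

      mod-· : ∀ m x → (m mod n) · x ≡ g ^ m * x
      mod-· m x = cong (_* x) (trans (cong (g ^_) (Fin.toℕ-fromℕ< (m%n<n m n))) (sym (g^m≡g^[m%n] m)))

      ⁻¹-· : ∀ k x → ((n ∸ toℕ k) mod n) · (k · x) ≡ x
      ⁻¹-· k x = begin
        ((n ∸ toℕ k) mod n) · (k · x)          ≡⟨ mod-· (n ∸ toℕ k) (k · x) ⟩
        g ^ (n ∸ toℕ k) * (g ^ toℕ k * x)      ≡⟨ sym (*-assoc _ _ x) ⟩
        (g ^ (n ∸ toℕ k) * g ^ toℕ k) * x      ≡⟨ cong (_* x) (sym (^-homo-* g (n ∸ toℕ k) (toℕ k))) ⟩
        g ^ (n ∸ toℕ k ℕ.+ toℕ k) * x          ≡⟨ cong (λ m → g ^ m * x) (ℕ.m∸n+n≡m (ℕ.<⇒≤ (Fin.toℕ<n k))) ⟩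
        g ^ n * x                              ≡⟨ trans (cong (_* x) gⁿ≡1) (*-identityˡ x) ⟩
        x                                      ∎

      free : ∀ j k {x} → x ≢ 0# → j · x ≡ k · x → j ≡ k
      free j k {x} x≢0 jx≡kx = Fin.toℕ-injective (^-injective (Fin.toℕ<n j) (Fin.toℕ<n k)
        (*-cancelˡ _ _ x≢0 (trans (*-comm x _) (trans jx≡kx (*-comm _ x)))))

      action : FreeAction (_≢ 0#)
      action = record
        { G = Fin n ; elements = allFin n ; elements-unique = Unique.allFin⁺ n ; ∈-elements = ∈-allFin
        ; _·_ = _·_ ; ·-closed = λ k x≢0 → x*y≢0 (g^j≢0 (ℕ.<⇒≤ (Fin.toℕ<n k))) x≢0
        ; ε = 0 mod n ; _∙_ = λ j k → (toℕ j ℕ.+ toℕ k) mod n ; _⁻¹ = λ k → (n ∸ toℕ k) mod n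
        ; ε-· = λ {x} _ → trans (mod-· 0 x) (*-identityˡ x)
        ; ∙-· = λ j k {x} _ → trans (mod-· (toℕ j ℕ.+ toℕ k) x)
                  (trans (cong (_* x) (^-homo-* g (toℕ j) (toℕ k))) (*-assoc _ _ x))
        ; ⁻¹-· = λ k {x} _ → ⁻¹-· k x
        ; free = free
        }

  -- Lagrange: the powers of g act freely on F ∖ {0} by multiplication.
  q%n≡1%n : ∀ {g n} .{{_ : NonZero n}} → g ^ n ≡ 1# → (∀ k → 0 < k → k < n → g ^ k ≢ 1#) → q % n ≡ 1 % n
  q%n≡1%n gⁿ≡1 g^k≢1 = q%d≡|¬P|%d (Cyclic.action gⁿ≡1 g^k≢1) (λ x → ¬? (x ≟ 0#)) (length-tabulate id)
    (0# ∷ []) ([] ∷ []) (λ {x} x≡0 → here (decidable-stable (x ≟ 0#) x≡0)) (λ { (here refl) x≢0 → x≢0 refl })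

  -- Every 0 < k < 8 has a multiple k * j ≡ 4 (mod 8), so s ^ k = 1 would force s ^ 4 = 1.
  k*j≡4-mod-8 : ∀ k → 0 < k → k < 8 → ∃ λ j → (k ℕ.* j) % 8 ≡ 4
  k*j≡4-mod-8 1 _ _ = 4 , refl
  k*j≡4-mod-8 2 _ _ = 2 , refl
  k*j≡4-mod-8 3 _ _ = 4 , refl
  k*j≡4-mod-8 4 _ _ = 1 , refl
  k*j≡4-mod-8 5 _ _ = 4 , refl
  k*j≡4-mod-8 6 _ _ = 2 , refl
  k*j≡4-mod-8 7 _ _ = 4 , refl
  k*j≡4-mod-8 (suc (suc (suc (suc (suc (suc (suc (suc _)))))))) _
    (s≤s (s≤s (s≤s (s≤s (s≤s (s≤s (s≤s (s≤s ()))))))))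

  s^4≡-1⇒q%8≡1 : two ≢ 0# → ∀ {s} → s ^ 4 ≡ - 1# → q % 8 ≡ 1
  s^4≡-1⇒q%8≡1 two≢0 {s} s⁴≡-1 = q%n≡1%n s⁸≡1 s^k≢1
    where
    s⁸≡1 : s ^ 8 ≡ 1#
    s⁸≡1 = begin
      s ^ 8                   ≡⟨ sym (^-assocʳ s 4 2) ⟩
      (s ^ 4) ^ 2             ≡⟨ cong (_^ 2) s⁴≡-1 ⟩
      - 1# * (- 1# * 1#)      ≡⟨ cong (- 1# *_) (*-identityʳ (- 1#)) ⟩
      - 1# * - 1#             ≡⟨ -x*-y≡x*y 1# 1# ⟩
      1# * 1#                 ≡⟨ *-identityˡ 1# ⟩
      1#                      ∎
    s^k≢1 : ∀ k → 0 < k → k < 8 → s ^ k ≢ 1#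
    s^k≢1 k 0<k k<8 s^k≡1 with k*j≡4-mod-8 k 0<k k<8
    ... | j , kj%8≡4 = 1≢-1 two≢0 (begin
      1#                  ≡⟨ sym (1^n≡1 j) ⟩
      1# ^ j              ≡⟨ cong (_^ j) (sym s^k≡1) ⟩
      (s ^ k) ^ j         ≡⟨ ^-assocʳ s k j ⟩
      s ^ (k ℕ.* j)       ≡⟨ Cyclic.g^m≡g^[m%n] s⁸≡1 (k ℕ.* j) ⟩
      s ^ (k ℕ.* j % 8)   ≡⟨ cong (s ^_) kj%8≡4 ⟩
      s ^ 4               ≡⟨ s⁴≡-1 ⟩
      - 1#                ∎)

-- Children in the graph

module Children {q : ℕ} (F : FiniteField q) where
  open FiniteField F
  open JGraph F
  open Field F
  open ≡-Reasoning

  twin : Vertex → Vertex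
  twin (c , d) = (c , - d)

  twin-≢ : two ≢ 0# → ∀ {u} → IsVertex u → u ≢ twin u
  twin-≢ two≢0 (_ , d≢0 , _) u≡twin = d≢0 (x≡-x⇒x≡0 two≢0 (cong proj₂ u≡twin))

  children-≡-or-twin : ∀ {v u w} → Edge v u → Edge v w → w ≡ u ⊎ w ≡ twin u
  children-≡-or-twin (_ , _ , c≡ , dd≡) (_ , _ , c′≡ , d′d′≡) with x*x≡y*y⇒x≡y⊎x≡-y (trans d′d′≡ (sym dd≡))
  ... | inj₁ d′≡d  = inj₁ (cong₂ _,_ (trans c′≡ (sym c≡)) d′≡d)
  ... | inj₂ d′≡-d = inj₂ (cong₂ _,_ (trans c′≡ (sym c≡)) d′≡-d)

  twin-child : IsSquare (- 1#) → ∀ {v u} → Edge v u → Edge v (twin u)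
  twin-child -1-square {u = c , d} (v-vertex , (c≢0 , d≢0 , (_ , cd-square) , c≢d , c≢-d) , c≡ , dd≡) =
    v-vertex , (c≢0 , -x≢0 d≢0 , (x*y≢0 c≢0 (-x≢0 d≢0) , c*-d-square) , c≢-d , c≢--d) , c≡ , trans (-x*-y≡x*y d d) dd≡
    where
    c*-d-square : IsSquare (c * - d)
    c*-d-square = subst IsSquare (trans (-1*x≈-x (c * d)) (-‿distribʳ-* c d)) (IsSquare-* -1-square cd-square)
    c≢--d : c ≢ - - d
    c≢--d c≡--d = c≢d (trans c≡--d (-‿involutive d))

  -- The first coordinates f, f′ of the two grandchildren multiply to a nonzero square, so the
  -- squareness of f g and f′ g′ passes to g g′.
  twin-grandchildren-g*g′-square : two ≢ 0# → ∀ {a b c d f g f′ g′} → Edge (a , b) (c , d) →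
    Edge (c , - d) (f , g) → Edge (c , d) (f′ , g′) → IsSquare (g * g′)
  twin-grandchildren-g*g′-square two≢0 {a} {b} {c} {d} {f} {g} {f′} {g′}
    (_ , _ , c≡ , dd≡ab)
    (_ , (f≢0 , _ , (_ , fg-square) , _) , f≡ , _)
    (_ , (f′≢0 , _ , (_ , f′g′-square) , _) , f′≡ , _) =
    IsSquare-cancelˡ (x*y≢0 f≢0 f′≢0) (((a + - b) * w) * w , ff′≡)
      (subst IsSquare (interchange f g f′ g′) (IsSquare-* fg-square f′g′-square))
    where
    w = two ⁻¹
    two*w≡1 = inverseʳ two two≢0
    ff′≡ : (((a + - b) * w) * w) * (((a + - b) * w) * w) ≡ f * f′
    ff′≡ = begin
      (((a + - b) * w) * w) * (((a + - b) * w) * w)      ≡⟨ interchange ((a + - b) * w) w ((a + - b) * w) w ⟩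
      (((a + - b) * w) * ((a + - b) * w)) * (w * w)      ≡⟨ cong (_* (w * w)) (sym ([c-d][c+d]≡[[a-b]w]² two*w≡1 c≡ dd≡ab)) ⟩
      ((c + - d) * (c + d)) * (w * w)                    ≡⟨ interchange (c + - d) (c + d) w w ⟩
      ((c + - d) * w) * ((c + d) * w)                    ≡⟨ sym (cong₂ _*_ f≡ f′≡) ⟩
      f * f′                                             ∎

  twin-childless : two ≢ 0# → (∀ s → s ^ 4 ≢ - 1#) → ∀ {v u w} → Edge v u → Edge u w → HasNoChildren (twin u)
  twin-childless two≢0 no-root {u = c , d} {w = f′ , g′} v→u u→w@((_ , _ , (cd≢0 , t , tt≡cd) , _) , _ , _ , g′g′≡cd)
    (f , g) twin→fg@(_ , _ , _ , gg≡c*-d) = no-root (m * t ⁻¹) (^4-quotient t≢0 m⁴≡-t⁴)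
    where
    m = proj₁ (twin-grandchildren-g*g′-square two≢0 v→u twin→fg u→w)
    mm≡gg′ = proj₂ (twin-grandchildren-g*g′-square two≢0 v→u twin→fg u→w)
    t≢0 : t ≢ 0#
    t≢0 t≡0 = cd≢0 (trans (sym tt≡cd) (trans (cong (_* t) t≡0) (zeroˡ t)))
    m⁴≡-t⁴ : m ^ 4 ≡ - (t ^ 4)
    m⁴≡-t⁴ = begin
      m ^ 4                          ≡⟨ x^4≡[x*x]*[x*x] m ⟩
      (m * m) * (m * m)              ≡⟨ cong (λ z → z * z) mm≡gg′ ⟩
      (g * g′) * (g * g′)            ≡⟨ [x*y]²≡x²*y² g g′ ⟩
      (g * g) * (g′ * g′)            ≡⟨ cong₂ _*_ gg≡c*-d g′g′≡cd ⟩
      (c * - d) * (c * d)            ≡⟨ cong (_* (c * d)) (sym (-‿distribʳ-* c d)) ⟩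
      - (c * d) * (c * d)            ≡⟨ sym (-‿distribˡ-* (c * d) (c * d)) ⟩
      - ((c * d) * (c * d))          ≡⟨ cong (λ z → - (z * z)) (sym tt≡cd) ⟩
      - ((t * t) * (t * t))          ≡⟨ cong -_ (sym (x^4≡[x*x]*[x*x] t)) ⟩
      - (t ^ 4)                      ∎

module FiveModEight {q : ℕ} (F : FiniteField q) (q%8≡5 : q % 8 ≡ 5) where
  open FiniteField F
  open JGraph F using (two; IsSquare)
  open Field F using (isSquare?; _^_)
  open Counting F

  q%d≡5%d : ∀ d .{{_ : NonZero d}} → d ∣ 8 → q % d ≡ 5 % d
  q%d≡5%d d d∣8 = trans (sym (m∣n⇒o%n%m≡o%m d 8 q d∣8)) (cong (_% d) q%8≡5)

  two≢0 : two ≢ 0#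
  two≢0 two≡0 with () ← trans (sym (q%d≡5%d 2 (divides 4 refl))) (two≡0⇒q%2≡0 two≡0)

  -1-square : IsSquare (- 1#)
  -1-square = decidable-stable (isSquare? (- 1#)) λ -1∉squares →
    case trans (sym (q%d≡5%d 4 (divides 2 refl))) (-1∉squares⇒q%4≡3 two≢0 -1∉squares) of λ ()

  ^4≢-1 : ∀ s → s ^ 4 ≢ - 1#
  ^4≢-1 s s⁴≡-1 with () ← trans (sym q%8≡5) (s^4≡-1⇒q%8≡1 two≢0 s⁴≡-1)

corollary5p3 : (q : ℕ) → (F : FiniteField q) → q % 8 ≡ 5 →
  (n : ℕ) → (cyc : JGraph.DirectedCycle F n) →
  ∀ c → JGraph._∈C_ F c cyc →
  ∃₂ λ u₁ u₂ → u₁ ≢ u₂ × JGraph.Edge F c u₁ × JGraph.Edge F c u₂ ×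
    (∀ w → JGraph.Edge F c w → w ≡ u₁ ⊎ w ≡ u₂) ×
    JGraph._∈C_ F u₁ cyc × JGraph.HasNoChildren F u₂
corollary5p3 q F q%8≡5 n cyc c (i , refl) =
  u , twin u , twin-≢ two≢0 (isVertex (next i)) , c→u , twin-child -1-square c→u ,
  (λ w c→w → children-≡-or-twin c→u c→w) , (next i , refl) , twin-childless two≢0 ^4≢-1 c→u (edge (next i))
  where
  open JGraph F using (next)
  open JGraph.DirectedCycle cyc
  open Children F
  open FiveModEight F q%8≡5
  u = vtx (next i)
  c→u = edge i
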